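{- Let $\mathcal{A}$ be a monoid of games (a set of games containing $0$ and closed under disjunctive sum). If $\mathcal{A}$ is Left weak (resp. Right weak), then every $G\in\mathcal{A}$ for which there is $H\in\mathcal{A}$ with $G+H\equiv_{\mathcal{A}}0$ is a Left end (resp. Right end). In particular, if $\mathcal{A}$ is weak, then $\mathcal{A}$ is reduced.
   Context: Games are short partizan game forms under the misère convention (a player unable to move wins); $o_L(G)\in\{\mathscr{L},\mathscr{R}\}$ is the winner when Left moves first; outcome classes ordered $\mathscr{L}>\mathscr{N}>\mathscr{R}$, $\mathscr{L}>\mathscr{P}>\mathscr{R}$. For a set of games $\mathcal{A}$, $G\geq_{\mathcal{A}}H$ iff $o(G+X)\geq o(H+X)$ for all $X\in\mathcal{A}$; $\equiv_{\mathcal{A}}$ means both directions. A Left end is a game with no Left options. Augmented forms (Siegel): game forms where each subposition may carry a Left and/or Right tombstone (markers, not options); an augmented form is Left end-like if it has no Left options or carries a Left tombstone; a player to move on a position end-like for them wins immediately; $G+H$ carries a Left tombstone iff both are Left end-like and at least one carries one. $G$ is Left $\mathcal{A}$-strong if $o_L(G+X)=\mathscr{L}$ for all Left ends $X\in\mathcal{A}$ (Right symmetrically). $\mathcal{A}$ is Left weak if an augmented form is Left $\mathcal{A}$-strong iff it is Left end-like; Right weak symmetrically; weak if both. $\mathcal{A}$ is reduced if every $G\in\mathcal{A}$ having some $H\in\mathcal{A}$ with $G+H\equiv_{\mathcal{A}}0$ satisfies $G\equiv_{\mathcal{A}}0$. -}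

module Defs where

open import Data.Bool using (Bool; true; false; _∧_; _∨_; not)
open import Data.List using (List; []; _∷_; _++_)
open import Data.Product using (Σ; _×_; _,_)
open import Data.Empty using (⊥)
open import Data.Unit using (⊤)
open import Relation.Binary.PropositionalEquality using (_≡_)

data Game : Set where
  mk : List Game → List Game → Game

leftOpts : Game → List Game
leftOpts (mk l r) = l

rightOpts : Game → List Game
rightOpts (mk l r) = r

zeroG : Game
zeroG = mk [] []

mutual
  _+_ : Game → Game → Game
  mk a b + mk c d = mk (addL a (mk c d) ++ addR (mk a b) c)
                       (addL b (mk c d) ++ addR (mk a b) d)

  addL : List Game → Game → List Game
  addL [] H = []
  addL (g ∷ gs) H = (g + H) ∷ addL gs H

  addR : Game → List Game → List Game
  addR G [] = []
  addR G (h ∷ hs) = (G + h) ∷ addR G hs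

infixl 6 _+_

IsLeftEnd : Game → Set
IsLeftEnd G = leftOpts G ≡ []

IsRightEnd : Game → Set
IsRightEnd G = rightOpts G ≡ []

-- Misère play: a player unable to move wins.
-- lwL G = true iff Left wins G when Left moves first  (o_L(G) = 𝓛)
-- lwR G = true iff Left wins G when Right moves first (o_R(G) = 𝓛)
mutual
  lwL : Game → Bool
  lwL (mk [] r) = true
  lwL (mk (x ∷ xs) r) = anyLwR (x ∷ xs)

  lwR : Game → Bool
  lwR (mk l []) = false
  lwR (mk l (x ∷ xs)) = allLwL (x ∷ xs)

  anyLwR : List Game → Bool
  anyLwR [] = false
  anyLwR (g ∷ gs) = lwR g ∨ anyLwR gs

  allLwL : List Game → Bool
  allLwL [] = true
  allLwL (g ∷ gs) = lwL g ∧ allLwL gs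

data Outcome : Set where
  𝓛 𝓝 𝓟 𝓡 : Outcome

outcomeOf : Bool → Bool → Outcome
outcomeOf true  true  = 𝓛
outcomeOf true  false = 𝓝
outcomeOf false true  = 𝓟
outcomeOf false false = 𝓡

o : Game → Outcome
o G = outcomeOf (lwL G) (lwR G)

_≥o_ : Outcome → Outcome → Set
𝓛 ≥o _ = ⊤
𝓝 ≥o 𝓝 = ⊤
𝓝 ≥o 𝓡 = ⊤
𝓟 ≥o 𝓟 = ⊤
𝓟 ≥o 𝓡 = ⊤
𝓡 ≥o 𝓡 = ⊤
_ ≥o _ = ⊥

GameSet : Set₁
GameSet = Game → Set

IsMonoid : GameSet → Set
IsMonoid 𝒜 = 𝒜 zeroG × (∀ G H → 𝒜 G → 𝒜 H → 𝒜 (G + H))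

_≥[_]_ : Game → GameSet → Game → Set
G ≥[ 𝒜 ] H = ∀ X → 𝒜 X → o (G + X) ≥o o (H + X)

_≡[_]_ : Game → GameSet → Game → Set
G ≡[ 𝒜 ] H = (G ≥[ 𝒜 ] H) × (H ≥[ 𝒜 ] G)

-- Augmented forms (Siegel): every subposition may carry a Left and/or
-- Right tombstone (markers, not options).
-- amk tL tR L R : tL = carries a Left tombstone, tR = carries a Right one.

data AGame : Set where
  amk : Bool → Bool → List AGame → List AGame → AGame

mutual
  ι : Game → AGame
  ι (mk l r) = amk false false (ιs l) (ιs r)

  ιs : List Game → List AGame
  ιs [] = []
  ιs (g ∷ gs) = ι g ∷ ιs gs

isNil : ∀ {A : Set} → List A → Bool
isNil [] = true
isNil (_ ∷ _) = false

leftEndLike : AGame → Bool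
leftEndLike (amk tL tR l r) = tL ∨ isNil l

rightEndLike : AGame → Bool
rightEndLike (amk tL tR l r) = tR ∨ isNil r

tombL : AGame → Bool
tombL (amk tL tR l r) = tL

tombR : AGame → Bool
tombR (amk tL tR l r) = tR

mutual
  _⊕_ : AGame → AGame → AGame
  amk a b la ra ⊕ amk c d lc rc =
    amk ((leftEndLike (amk a b la ra) ∧ leftEndLike (amk c d lc rc)) ∧ (a ∨ c))
        ((rightEndLike (amk a b la ra) ∧ rightEndLike (amk c d lc rc)) ∧ (b ∨ d))
        (aaddL la (amk c d lc rc) ++ aaddR (amk a b la ra) lc)
        (aaddL ra (amk c d lc rc) ++ aaddR (amk a b la ra) rc)

  aaddL : List AGame → AGame → List AGame
  aaddL [] H = []
  aaddL (g ∷ gs) H = (g ⊕ H) ∷ aaddL gs H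

  aaddR : AGame → List AGame → List AGame
  aaddR G [] = []
  aaddR G (h ∷ hs) = (G ⊕ h) ∷ aaddR G hs

infixl 6 _⊕_

mutual
  alwL : AGame → Bool
  alwL (amk true  tR l r) = true
  alwL (amk false tR [] r) = true
  alwL (amk false tR (x ∷ xs) r) = aanyLwR (x ∷ xs)

  alwR : AGame → Bool
  alwR (amk tL true l r) = false
  alwR (amk tL false l []) = false
  alwR (amk tL false l (x ∷ xs)) = aallLwL (x ∷ xs)

  aanyLwR : List AGame → Bool
  aanyLwR [] = false
  aanyLwR (g ∷ gs) = alwR g ∨ aanyLwR gs

  aallLwL : List AGame → Bool
  aallLwL [] = true
  aallLwL (g ∷ gs) = alwL g ∧ aallLwL gs

oL≡𝓛 : AGame → Set
oL≡𝓛 G = alwL G ≡ true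

oR≡𝓡 : AGame → Set
oR≡𝓡 G = alwR G ≡ false

LeftStrong : GameSet → AGame → Set
LeftStrong 𝒜 G = ∀ X → 𝒜 X → IsLeftEnd X → oL≡𝓛 (G ⊕ ι X)

RightStrong : GameSet → AGame → Set
RightStrong 𝒜 G = ∀ X → 𝒜 X → IsRightEnd X → oR≡𝓡 (G ⊕ ι X)

LeftWeak : GameSet → Set
LeftWeak 𝒜 = ∀ G → (LeftStrong 𝒜 G → leftEndLike G ≡ true)
                 × (leftEndLike G ≡ true → LeftStrong 𝒜 G)

RightWeak : GameSet → Set
RightWeak 𝒜 = ∀ G → (RightStrong 𝒜 G → rightEndLike G ≡ true)
                  × (rightEndLike G ≡ true → RightStrong 𝒜 G)

Weak : GameSet → Set
Weak 𝒜 = LeftWeak 𝒜 × RightWeak 𝒜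

Invertible : GameSet → Game → Set
Invertible 𝒜 G = Σ Game (λ H → 𝒜 H × ((G + H) ≡[ 𝒜 ] zeroG))

Reduced : GameSet → Set
Reduced 𝒜 = ∀ G → 𝒜 G → Invertible 𝒜 G → G ≡[ 𝒜 ] zeroG

{-# OPTIONS --safe #-}

-- If G + H ≡ 0 modulo 𝒜, then for every Left end X ∈ 𝒜 Left wins G + H + X
-- moving first, just as she wins 0 + X = X; so G + H, read as an augmented
-- form without tombstones, is Left 𝒜-strong, and Left weakness makes it a
-- Left end. A Left option of G would give one of G + H, so G is a Left end.
-- Under weakness G is then both a Left and a Right end, i.e. G = 0.

module Submission where

open import Defs
open import Data.Product using (_×_; _,_; proj₁; proj₂)
open import Data.Bool using (true; false; _∧_; _∨_)
open import Data.Bool.Properties using (∧-zeroʳ)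
open import Data.List using ([]; _∷_; _++_)
open import Data.Unit using (tt)
open import Relation.Binary.PropositionalEquality
  using (_≡_; refl; sym; trans; cong; cong₂; subst; module ≡-Reasoning)

mutual
  +-identityˡ : ∀ G → zeroG + G ≡ G
  +-identityˡ (mk l r) = cong₂ mk (addR-zeroG l) (addR-zeroG r)

  addR-zeroG : ∀ gs → addR zeroG gs ≡ gs
  addR-zeroG []       = refl
  addR-zeroG (g ∷ gs) = cong₂ _∷_ (+-identityˡ g) (addR-zeroG gs)

leftEnd-+⇒leftEndˡ : ∀ G H → IsLeftEnd (G + H) → IsLeftEnd G
leftEnd-+⇒leftEndˡ (mk [] _) (mk _ _) _ = refl

rightEnd-+⇒rightEndˡ : ∀ G H → IsRightEnd (G + H) → IsRightEnd G
rightEnd-+⇒rightEndˡ (mk _ []) (mk _ _) _ = refl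

leftEnd×rightEnd⇒≡zeroG : ∀ G → IsLeftEnd G → IsRightEnd G → G ≡ zeroG
leftEnd×rightEnd⇒≡zeroG (mk [] []) _ _ = refl

lwL-leftEnd : ∀ G → IsLeftEnd G → lwL G ≡ true
lwL-leftEnd (mk [] _) _ = refl

lwR-rightEnd : ∀ G → IsRightEnd G → lwR G ≡ false
lwR-rightEnd (mk _ []) _ = refl

≥o-refl : ∀ x → x ≥o x
≥o-refl 𝓛 = tt
≥o-refl 𝓝 = tt
≥o-refl 𝓟 = tt
≥o-refl 𝓡 = tt

≡[]-refl : ∀ 𝒜 G → G ≡[ 𝒜 ] G
≡[]-refl 𝒜 G = (λ X _ → ≥o-refl (o (G + X))) , (λ X _ → ≥o-refl (o (G + X)))

lwL-monotone : ∀ G H → o G ≥o o H → lwL H ≡ true → lwL G ≡ true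
lwL-monotone G H = go (lwL G) (lwR G) (lwL H) (lwR H)
  where
  go : ∀ a b c d → outcomeOf a b ≥o outcomeOf c d → c ≡ true → a ≡ true
  go true  _     _     _     _  _  = refl
  go false _     false _     _  ()
  go false true  true  true  () _
  go false true  true  false () _
  go false false true  true  () _
  go false false true  false () _

lwR-monotone : ∀ G H → o G ≥o o H → lwR G ≡ false → lwR H ≡ false
lwR-monotone G H = go (lwL G) (lwR G) (lwL H) (lwR H)
  where
  go : ∀ a b c d → outcomeOf a b ≥o outcomeOf c d → b ≡ false → d ≡ false
  go _     _     _     false _  _  = refl
  go _     true  _     true  _  ()
  go true  false true  true  () _
  go true  false false true  () _
  go false false true  true  () _
  go false false false true  () _

ιs-++ : ∀ gs hs → ιs (gs ++ hs) ≡ ιs gs ++ ιs hs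
ιs-++ []       hs = refl
ιs-++ (g ∷ gs) hs = cong (ι g ∷_) (ιs-++ gs hs)

untombstoned-≡ : ∀ {s t l r l′ r′} →
                s ≡ false → t ≡ false → l ≡ l′ → r ≡ r′ → amk false false l r ≡ amk s t l′ r′
untombstoned-≡ refl refl refl refl = refl

mutual
  ι-+ : ∀ G H → ι (G + H) ≡ ι G ⊕ ι H
  ι-+ (mk a b) (mk c d) = untombstoned-≡
    (∧-zeroʳ (isNil (ιs a) ∧ isNil (ιs c)))
    (∧-zeroʳ (isNil (ιs b) ∧ isNil (ιs d)))
    (trans (ιs-++ (addL a (mk c d)) _) (cong₂ _++_ (ιs-addL a (mk c d)) (ιs-addR (mk a b) c)))
    (trans (ιs-++ (addL b (mk c d)) _) (cong₂ _++_ (ιs-addL b (mk c d)) (ιs-addR (mk a b) d)))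

  ιs-addL : ∀ gs H → ιs (addL gs H) ≡ aaddL (ιs gs) (ι H)
  ιs-addL []       H = refl
  ιs-addL (g ∷ gs) H = cong₂ _∷_ (ι-+ g H) (ιs-addL gs H)

  ιs-addR : ∀ G hs → ιs (addR G hs) ≡ aaddR (ι G) (ιs hs)
  ιs-addR G []       = refl
  ιs-addR G (h ∷ hs) = cong₂ _∷_ (ι-+ G h) (ιs-addR G hs)

mutual
  alwL-ι : ∀ G → alwL (ι G) ≡ lwL G
  alwL-ι (mk []       _) = refl
  alwL-ι (mk (g ∷ gs) _) = aanyLwR-ιs (g ∷ gs)

  alwR-ι : ∀ G → alwR (ι G) ≡ lwR G
  alwR-ι (mk _ [])       = refl
  alwR-ι (mk _ (g ∷ gs)) = aallLwL-ιs (g ∷ gs)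

  aanyLwR-ιs : ∀ gs → aanyLwR (ιs gs) ≡ anyLwR gs
  aanyLwR-ιs []       = refl
  aanyLwR-ιs (g ∷ gs) = cong₂ _∨_ (alwR-ι g) (aanyLwR-ιs gs)

  aallLwL-ιs : ∀ gs → aallLwL (ιs gs) ≡ allLwL gs
  aallLwL-ιs []       = refl
  aallLwL-ιs (g ∷ gs) = cong₂ _∧_ (alwL-ι g) (aallLwL-ιs gs)

leftEndLike-ι⇒leftEnd : ∀ G → leftEndLike (ι G) ≡ true → IsLeftEnd G
leftEndLike-ι⇒leftEnd (mk [] _) _ = refl

rightEndLike-ι⇒rightEnd : ∀ G → rightEndLike (ι G) ≡ true → IsRightEnd G
rightEndLike-ι⇒rightEnd (mk _ []) _ = refl

module _ (𝒜 : GameSet) where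

  ≥0⇒leftStrong : ∀ G → G ≥[ 𝒜 ] zeroG → LeftStrong 𝒜 (ι G)
  ≥0⇒leftStrong G G≥0 X X∈𝒜 X-end = begin
    alwL (ι G ⊕ ι X)   ≡⟨ cong alwL (sym (ι-+ G X)) ⟩
    alwL (ι (G + X))   ≡⟨ alwL-ι (G + X) ⟩
    lwL (G + X)        ≡⟨ lwL-monotone (G + X) (zeroG + X) (G≥0 X X∈𝒜) 0+X-wins ⟩
    true               ∎
    where
    open ≡-Reasoning
    0+X-wins : lwL (zeroG + X) ≡ true
    0+X-wins = subst (λ Y → lwL Y ≡ true) (sym (+-identityˡ X)) (lwL-leftEnd X X-end)

  ≤0⇒rightStrong : ∀ G → zeroG ≥[ 𝒜 ] G → RightStrong 𝒜 (ι G)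
  ≤0⇒rightStrong G 0≥G X X∈𝒜 X-end = begin
    alwR (ι G ⊕ ι X)   ≡⟨ cong alwR (sym (ι-+ G X)) ⟩
    alwR (ι (G + X))   ≡⟨ alwR-ι (G + X) ⟩
    lwR (G + X)        ≡⟨ lwR-monotone (zeroG + X) (G + X) (0≥G X X∈𝒜) 0+X-wins ⟩
    false              ∎
    where
    open ≡-Reasoning
    0+X-wins : lwR (zeroG + X) ≡ false
    0+X-wins = subst (λ Y → lwR Y ≡ false) (sym (+-identityˡ X)) (lwR-rightEnd X X-end)

  leftWeak⇒≥0⇒leftEnd : LeftWeak 𝒜 → ∀ G → G ≥[ 𝒜 ] zeroG → IsLeftEnd G
  leftWeak⇒≥0⇒leftEnd weak G G≥0 =
    leftEndLike-ι⇒leftEnd G (proj₁ (weak (ι G)) (≥0⇒leftStrong G G≥0))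

  rightWeak⇒≤0⇒rightEnd : RightWeak 𝒜 → ∀ G → zeroG ≥[ 𝒜 ] G → IsRightEnd G
  rightWeak⇒≤0⇒rightEnd weak G 0≥G =
    rightEndLike-ι⇒rightEnd G (proj₁ (weak (ι G)) (≤0⇒rightStrong G 0≥G))

  leftWeak⇒invertible⇒leftEnd : LeftWeak 𝒜 → ∀ G → Invertible 𝒜 G → IsLeftEnd G
  leftWeak⇒invertible⇒leftEnd weak G (H , _ , G+H≡0) =
    leftEnd-+⇒leftEndˡ G H (leftWeak⇒≥0⇒leftEnd weak (G + H) (proj₁ G+H≡0))

  rightWeak⇒invertible⇒rightEnd : RightWeak 𝒜 → ∀ G → Invertible 𝒜 G → IsRightEnd G
  rightWeak⇒invertible⇒rightEnd weak G (H , _ , G+H≡0) =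
    rightEnd-+⇒rightEndˡ G H (rightWeak⇒≤0⇒rightEnd weak (G + H) (proj₂ G+H≡0))

  weak⇒reduced : Weak 𝒜 → Reduced 𝒜
  weak⇒reduced (leftWeak , rightWeak) G _ G-inv =
    subst (_≡[ 𝒜 ] zeroG) (sym G≡0) (≡[]-refl 𝒜 zeroG)
    where
    G≡0 : G ≡ zeroG
    G≡0 = leftEnd×rightEnd⇒≡zeroG G
            (leftWeak⇒invertible⇒leftEnd leftWeak G G-inv)
            (rightWeak⇒invertible⇒rightEnd rightWeak G G-inv)

proposition5p4 : (𝒜 : GameSet) → IsMonoid 𝒜 →
    ((LeftWeak 𝒜 → ∀ G → 𝒜 G → Invertible 𝒜 G → IsLeftEnd G)
    × (RightWeak 𝒜 → ∀ G → 𝒜 G → Invertible 𝒜 G → IsRightEnd G))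
    × (Weak 𝒜 → Reduced 𝒜)
proposition5p4 𝒜 _ =
  ( (λ leftWeak G _ → leftWeak⇒invertible⇒leftEnd 𝒜 leftWeak G)
  , (λ rightWeak G _ → rightWeak⇒invertible⇒rightEnd 𝒜 rightWeak G) )
  , weak⇒reduced 𝒜
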